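{- Let $\sigma$ be a finite set of unary relation symbols containing $X$, let $C_1,C_2$ be disjoint finite sets of constant symbols, and let $\tau_i=\{E\}\cup\sigma\cup C_i$ for $i=1,2$. Let $c_1\in C_1$ and $c_2\in C_2$. For every $n<\omega$ there is a binary operation $\oplus^n_{c_1,c_2}$, taking an $X$-positive $n$-type of $\tau_1$-structures and an $X$-positive $n$-type of $\tau_2$-structures to an $X$-positive $n$-type of $(\tau_1\cup\tau_2)$-structures, such that: (i) for all tree structures $\mathfrak{T}_1$ of vocabulary $\tau_1$ and $\mathfrak{T}_2$ of vocabulary $\tau_2$ with disjoint universes, $$\mathrm{tp}^n_X(\mathfrak{T}_1+_{c_1,c_2}\mathfrak{T}_2)=\mathrm{tp}^n_X(\mathfrak{T}_1)\oplus^n_{c_1,c_2}\mathrm{tp}^n_X(\mathfrak{T}_2);$$ (ii) $\oplus^n_{c_1,c_2}$ is monotone: $t_1\subseteq t_1'$ and $t_2\subseteq t_2'$ imply $t_1\oplus^n_{c_1,c_2}t_2\subseteq t_1'\oplus^n_{c_1,c_2}t_2'$; (iii) $t_1\oplus^n_{c_1,c_2}t_2$ is computable from $n$, $t_1$ and $t_2$.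
   Context: A tree structure is a structure over a vocabulary consisting of one binary symbol $E$ plus unary relation and constant symbols, in which $E$ is symmetric, acyclic and connected. For a vocabulary $\tau$ containing the unary symbol $X$, $\mathrm{MSO}^n_X[\tau]$ denotes the set of monadic second-order sentences over $\tau$ of quantifier rank at most $n$ (counting first- and second-order quantifiers) in which $X$ occurs only positively; up to logical equivalence this is a finite set, and types are represented finitely by normal-form representatives. The $X$-positive $n$-type of a $\tau$-structure $\mathfrak{A}$ is $\mathrm{tp}^n_X(\mathfrak{A})=\{\varphi\in\mathrm{MSO}^n_X[\tau] : \mathfrak{A}\models\varphi\}$. For tree structures $\mathfrak{T}_1,\mathfrak{T}_2$ with disjoint universes and no constant symbol interpreted in both, $\mathfrak{T}_1+_{c_1,c_2}\mathfrak{T}_2$ is the tree structure (over the union of the vocabularies) obtained from the disjoint union of $\mathfrak{T}_1$ and $\mathfrak{T}_2$ by adding an (undirected) $E$-edge between $c_1^{\mathfrak{T}_1}$ and $c_2^{\mathfrak{T}_2}$. -}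

module Defs where

open import Level using (Lift) renaming (suc to lsuc; zero to lzero)
open import Data.Nat using (ℕ; zero; suc; _≤ᵇ_; _⊔_; _≤_)
open import Data.Fin using (Fin; _≟_) renaming (zero to fzero; suc to fsuc)
open import Data.Bool using (Bool; true; false; not; if_then_else_; T; _∧_)
open import Data.Sum using (_⊎_; inj₁; inj₂)
open import Data.Product using (Σ; _×_; _,_; proj₁)
open import Data.Empty using (⊥)
open import Data.List using (List; []; _∷_; _++_; [_]; length)
open import Data.List.Relation.Unary.Linked using (Linked)
open import Data.List.Relation.Unary.AllPairs using (AllPairs)
open import Relation.Nullary using (¬_; Dec)
open import Relation.Nullary.Decidable using (⌊_⌋; isYes)
open import Relation.Binary.PropositionalEquality using (_≡_; _≢_)

-- Vocabularies: {E} ∪ σ ∪ C, where σ = Fin s (unary symbols) and C is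
-- the set of constant symbols.  Structures over such a vocabulary.

record Structure (s : ℕ) (C : Set) : Set₁ where
  field
    Carrier : Set
    E       : Carrier → Carrier → Set
    P       : Fin s → Carrier → Set
    con     : C → Carrier
open Structure public

data Walk {A : Set} (R : A → A → Set) : A → A → Set where
  here : ∀ {a} → Walk R a a
  step : ∀ {a b c} → R a b → Walk R b c → Walk R a c

-- tree structure: E symmetric, acyclic (no loops, no cycles of length ≥ 3
-- through pairwise distinct vertices), connected
record IsTree {s : ℕ} {C : Set} (M : Structure s C) : Set where
  field
    symmetric : ∀ a b → E M a b → E M b a
    noLoop    : ∀ a → ¬ E M a a
    noCycle   : ∀ v vs → 2 ≤ length vs → AllPairs _≢_ (v ∷ vs) →
                ¬ Linked (E M) (v ∷ vs ++ [ v ])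
    connected : ∀ a b → Walk (E M) a b

module _ {s : ℕ} {C₁ C₂ : Set} (T₁ : Structure s C₁) (c₁ : C₁)
         (c₂ : C₂) (T₂ : Structure s C₂) where
  private
    A = Carrier T₁ ⊎ Carrier T₂

    E+ : A → A → Set
    E+ (inj₁ a) (inj₁ b) = E T₁ a b
    E+ (inj₂ a) (inj₂ b) = E T₂ a b
    E+ (inj₁ a) (inj₂ b) = (a ≡ con T₁ c₁) × (b ≡ con T₂ c₂)
    E+ (inj₂ a) (inj₁ b) = (a ≡ con T₂ c₂) × (b ≡ con T₁ c₁)

    P+ : Fin s → A → Set
    P+ u (inj₁ a) = P T₁ u a
    P+ u (inj₂ a) = P T₂ u a

    con+ : C₁ ⊎ C₂ → A
    con+ (inj₁ k) = inj₁ (con T₁ k)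
    con+ (inj₂ k) = inj₂ (con T₂ k)

  _+[_,_]_ : Structure s (C₁ ⊎ C₂)
  _+[_,_]_ = record { Carrier = A ; E = E+ ; P = P+ ; con = con+ }

-- MSO syntax: Formula s C m k has m first-order and k second-order
-- (monadic) free variables (de Bruijn).

data Term (C : Set) (m : ℕ) : Set where
  var : Fin m → Term C m
  cst : C → Term C m

data Formula (s : ℕ) (C : Set) : ℕ → ℕ → Set where
  edge : ∀ {m k} → Term C m → Term C m → Formula s C m k
  eq   : ∀ {m k} → Term C m → Term C m → Formula s C m k
  rel  : ∀ {m k} → Fin s → Term C m → Formula s C m k
  mem  : ∀ {m k} → Fin k → Term C m → Formula s C m k
  neg  : ∀ {m k} → Formula s C m k → Formula s C m k
  and  : ∀ {m k} → Formula s C m k → Formula s C m k → Formula s C m k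
  or   : ∀ {m k} → Formula s C m k → Formula s C m k → Formula s C m k
  ex1  : ∀ {m k} → Formula s C (suc m) k → Formula s C m k
  all1 : ∀ {m k} → Formula s C (suc m) k → Formula s C m k
  ex2  : ∀ {m k} → Formula s C m (suc k) → Formula s C m k
  all2 : ∀ {m k} → Formula s C m (suc k) → Formula s C m k

qr : ∀ {s C m k} → Formula s C m k → ℕ
qr (edge _ _) = 0
qr (eq _ _)   = 0
qr (rel _ _)  = 0
qr (mem _ _)  = 0
qr (neg φ)    = qr φ
qr (and φ ψ)  = qr φ ⊔ qr ψ
qr (or φ ψ)   = qr φ ⊔ qr ψ
qr (ex1 φ)    = suc (qr φ)
qr (all1 φ)   = suc (qr φ)
qr (ex2 φ)    = suc (qr φ)
qr (all2 φ)   = suc (qr φ)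

-- polarOK X p φ : every occurrence of X in φ has polarity p
-- (true = positive, i.e. under an even number of negations)
polarOK : ∀ {s C m k} → Fin s → Bool → Formula s C m k → Bool
polarOK X p (edge _ _) = true
polarOK X p (eq _ _)   = true
polarOK X p (rel u _)  = if ⌊ u ≟ X ⌋ then p else true
polarOK X p (mem _ _)  = true
polarOK X p (neg φ)    = polarOK X (not p) φ
polarOK X p (and φ ψ)  = polarOK X p φ ∧ polarOK X p ψ
polarOK X p (or φ ψ)   = polarOK X p φ ∧ polarOK X p ψ
polarOK X p (ex1 φ)    = polarOK X p φ
polarOK X p (all1 φ)   = polarOK X p φ
polarOK X p (ex2 φ)    = polarOK X p φ
polarOK X p (all2 φ)   = polarOK X p φ

ext : ∀ {m} {B : Set₁} → (Fin m → B) → B → Fin (suc m) → B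
ext ρ b fzero    = b
ext ρ b (fsuc i) = ρ i

ext₀ : ∀ {m} {B : Set} → (Fin m → B) → B → Fin (suc m) → B
ext₀ ρ b fzero    = b
ext₀ ρ b (fsuc i) = ρ i

⟦_⟧t : ∀ {s C m} → Term C m → (M : Structure s C) → (Fin m → Carrier M) → Carrier M
⟦ var i ⟧t M ρ = ρ i
⟦ cst c ⟧t M ρ = con M c

Sat : ∀ {s C m k} (M : Structure s C) → (Fin m → Carrier M) →
      (Fin k → Carrier M → Set) → Formula s C m k → Set₁
Sat M ρ η (edge t u) = Lift (lsuc lzero) (E M (⟦ t ⟧t M ρ) (⟦ u ⟧t M ρ))
Sat M ρ η (eq t u)   = Lift (lsuc lzero) (⟦ t ⟧t M ρ ≡ ⟦ u ⟧t M ρ)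
Sat M ρ η (rel v t)  = Lift (lsuc lzero) (P M v (⟦ t ⟧t M ρ))
Sat M ρ η (mem j t)  = Lift (lsuc lzero) (η j (⟦ t ⟧t M ρ))
Sat M ρ η (neg φ)    = ¬ Sat M ρ η φ
Sat M ρ η (and φ ψ)  = Sat M ρ η φ × Sat M ρ η ψ
Sat M ρ η (or φ ψ)   = Sat M ρ η φ ⊎ Sat M ρ η ψ
Sat M ρ η (ex1 φ)    = Σ (Carrier M) λ a → Sat M (ext₀ ρ a) η φ
Sat M ρ η (all1 φ)   = (a : Carrier M) → Sat M (ext₀ ρ a) η φ
Sat M ρ η (ex2 φ)    = Σ (Carrier M → Set) λ Q → Sat M ρ (ext η Q) φ
Sat M ρ η (all2 φ)   = (Q : Carrier M → Set) → Sat M ρ (ext η Q) φ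

_⊨_ : ∀ {s C} (M : Structure s C) → Formula s C 0 0 → Set₁
M ⊨ φ = Sat M (λ ()) (λ ()) φ

-- MSO^n_X[τ]: sentences of quantifier rank ≤ n in which X occurs only
-- positively.  An X-positive n-type is represented by its
-- characteristic function on MSO^n_X[τ].

MSO : (s : ℕ) → Fin s → (C : Set) → ℕ → Set
MSO s X C n = Σ (Formula s C 0 0) λ φ → T (qr φ ≤ᵇ n) × T (polarOK X true φ)

TypeRep : (s : ℕ) → Fin s → (C : Set) → ℕ → Set
TypeRep s X C n = MSO s X C n → Bool

LEM : Set₂
LEM = (A : Set₁) → Dec A

tp : ∀ {s C} → LEM → (X : Fin s) (n : ℕ) → Structure s C → TypeRep s X C n
tp lem X n M φ = isYes (lem (M ⊨ proj₁ φ))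

_⊆ᵗ_ : ∀ {s X C n} → TypeRep s X C n → TypeRep s X C n → Set
t ⊆ᵗ t' = ∀ φ → T (t φ) → T (t' φ)

-- Feferman–Vaught for the edge sum.  A formula over T₁ +[ c₁ , c₂ ] T₂ is
-- translated into a finite disjunction of pairs (ψ , χ), read as "T₁ ⊨ ψ and
-- T₂ ⊨ χ": every free variable is assigned to one of the two summands, a
-- quantifier over the sum becomes a disjunction of quantifiers over either
-- summand, and an edge across the summands can only be the edge c₁ — c₂.
-- Negation is pushed through the disjunction classically (hence LEM).  The
-- translation does not raise quantifier rank and keeps the polarity of X, so
-- the n-type of the sum is obtained from the n-types of the summands by
-- evaluating this disjunction, which is monotone in the types.
module Submission where

open import Defs
open import Level using (Lift; lift; 0ℓ) renaming (suc to lsuc)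
open import Data.Nat using (ℕ; suc; _≤_; _≤ᵇ_; z≤n; s≤s)
open import Data.Nat.Properties using (⊔-lub; m⊔n≤o⇒m≤o; m⊔n≤o⇒n≤o; ≤ᵇ⇒≤; ≤⇒≤ᵇ)
open import Data.Fin using (Fin) renaming (zero to fzero; suc to fsuc)
open import Data.Bool using (Bool; true; false; not; T; _∧_)
open import Data.Bool.Properties using (T-∧)
open import Data.Unit using (tt)
open import Data.Sum using (_⊎_; inj₁; inj₂; [_,_]′)
open import Data.Sum.Properties using (inj₁-injective; inj₂-injective)
open import Data.Sum.Function.Propositional using (_⊎-⇔_)
open import Data.Product using (Σ; _×_; _,_; proj₁; proj₂; map₂)
open import Data.Product.Function.NonDependent.Propositional using (_×-⇔_)
open import Data.Empty using (⊥-elim)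
open import Data.List using (List; []; _∷_; _++_; [_]; map; cartesianProductWith)
open import Data.Bool.ListAction using (any)
open import Data.List.Relation.Unary.All as All using (All; []; _∷_)
import Data.List.Relation.Unary.All.Properties as Allₚ
open import Data.List.Relation.Unary.Any as Any using (Any; here; there)
import Data.List.Relation.Unary.Any.Properties as Anyₚ
open import Function using (_∘_; id)
open import Function.Bundles using (_⇔_; mk⇔; Equivalence)
open import Function.Properties.Equivalence using () renaming (trans to ⇔-trans; sym to ⇔-sym)
open import Function.Properties.Inverse using (↔⇒⇔)
open import Function.Related.TypeIsomorphisms using (¬-cong-⇔; Σ-distribʳ-⊎)
open import Relation.Nullary using (¬_; yes; no)
open import Relation.Nullary.Decidable using (T?; _×-dec_; toWitness; fromWitness; isYes≗does; does-⇔)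
open import Relation.Binary.PropositionalEquality using (_≡_; refl; sym; trans; cong; subst; _≗_; setoid)

open Equivalence using (to; from)

private
  variable
    m k : ℕ

Σ-cong-⇔ : ∀ {a p q} {A : Set a} {P : A → Set p} {Q : A → Set q} →
           (∀ x → P x ⇔ Q x) → Σ A P ⇔ Σ A Q
Σ-cong-⇔ P⇔Q = mk⇔ (map₂ (to (P⇔Q _))) (map₂ (from (P⇔Q _)))

Any-cong-⇔ᴬ : ∀ {a p q r} {A : Set a} {P : A → Set p} {Q : A → Set q} {R : A → Set r}
              {xs : List A} → All R xs → (∀ {x} → R x → P x ⇔ Q x) → Any P xs ⇔ Any Q xs
Any-cong-⇔ᴬ []       P⇔Q = mk⇔ (λ ()) (λ ())
Any-cong-⇔ᴬ (r ∷ rs) P⇔Q = mk⇔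
  (λ { (here p) → here (to (P⇔Q r) p) ; (there ps) → there (to (Any-cong-⇔ᴬ rs P⇔Q) ps) })
  (λ { (here q) → here (from (P⇔Q r) q) ; (there qs) → there (from (Any-cong-⇔ᴬ rs P⇔Q) qs) })

module _ (lem : LEM) {a} {A : Set a} {P : A → Set₁} where

  ∀⇔¬∃¬ : ((x : A) → P x) ⇔ (¬ Σ A (¬_ ∘ P))
  ∀⇔¬∃¬ = mk⇔ (λ ∀P (x , ¬Px) → ¬Px (∀P x)) stable
    where
    stable : ¬ Σ A (¬_ ∘ P) → (x : A) → P x
    stable ¬∃¬P x with lem (P x)
    ... | yes Px = Px
    ... | no ¬Px = ⊥-elim (¬∃¬P (x , ¬Px))

InFragment : ∀ {s C} → Fin s → ℕ → Bool → Formula s C m k → Set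
InFragment X r p φ = qr φ ≤ r × T (polarOK X p φ)

module TypeMembership {s : ℕ} (X : Fin s) (n : ℕ) where

  -- Extends a type to all sentences, answering false outside MSO^n_X.
  contains : ∀ {C} → TypeRep s X C n → Formula s C 0 0 → Bool
  contains t ψ with T? (qr ψ ≤ᵇ n) ×-dec T? (polarOK X true ψ)
  ... | yes ψ∈MSO = t (ψ , ψ∈MSO)
  ... | no  _     = false

  contains-mono : ∀ {C} {t t′ : TypeRep s X C n} → t ⊆ᵗ t′ →
                  ∀ ψ → T (contains t ψ) → T (contains t′ ψ)
  contains-mono t⊆t′ ψ with T? (qr ψ ≤ᵇ n) ×-dec T? (polarOK X true ψ)
  ... | yes ψ∈MSO = t⊆t′ (ψ , ψ∈MSO)

  contains-tp : ∀ {C} (lem : LEM) (M : Structure s C) {ψ} → InFragment X n true ψ →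
                T (contains (tp lem X n M) ψ) ⇔ (M ⊨ ψ)
  contains-tp lem M {ψ} (r , pol) with T? (qr ψ ≤ᵇ n) ×-dec T? (polarOK X true ψ)
  ... | yes _    = mk⇔ toWitness fromWitness
  ... | no  ψ∉MSO = ⊥-elim (ψ∉MSO (≤⇒≤ᵇ r , pol))

data Side : Set where
  left right : Side

module Decomposition {s : ℕ} {C₁ C₂ : Set} (c₁ : C₁) (c₂ : C₂) where

  Clause : ℕ → ℕ → Set
  Clause m k = Formula s C₁ m k × Formula s C₂ m k

  DNF : ℕ → ℕ → Set
  DNF m k = List (Clause m k)

  -- The syntax has no truth constant; c = c plays its role.
  ⊤ᶠ : ∀ {C} → C → Formula s C m k
  ⊤ᶠ c = eq (cst c) (cst c)

  _∧ᶜ_ : Clause m k → Clause m k → Clause m k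
  (ψ , χ) ∧ᶜ (ψ′ , χ′) = and ψ ψ′ , and χ χ′

  _∧ᴰ_ : DNF m k → DNF m k → DNF m k
  _∧ᴰ_ = cartesianProductWith _∧ᶜ_

  ¬ᴰ : DNF m k → DNF m k
  ¬ᴰ []            = [ ⊤ᶠ c₁ , ⊤ᶠ c₂ ]
  ¬ᴰ ((ψ , χ) ∷ D) = ((neg ψ , ⊤ᶠ c₂) ∷ (⊤ᶠ c₁ , neg χ) ∷ []) ∧ᴰ ¬ᴰ D

  -- The new variable lives on one side; on the other side it is pinned to
  -- the constant, which the translated formula there never mentions.
  ∃ˡ ∃ʳ : Clause (suc m) k → Clause m k
  ∃ˡ (ψ , χ) = ex1 ψ , ex1 (and (eq (var fzero) (cst c₂)) χ)
  ∃ʳ (ψ , χ) = ex1 (and (eq (var fzero) (cst c₁)) ψ) , ex1 χ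

  ∃ᴰ : DNF (suc m) k → DNF (suc m) k → DNF m k
  ∃ᴰ D₁ D₂ = map ∃ˡ D₁ ++ map ∃ʳ D₂

  ∃²ᶜ : Clause m (suc k) → Clause m k
  ∃²ᶜ (ψ , χ) = ex2 ψ , ex2 χ

  SplitTerm : ℕ → Set
  SplitTerm m = Term C₁ m ⊎ Term C₂ m

  varOn : Side → Fin m → SplitTerm m
  varOn left  i = inj₁ (var i)
  varOn right i = inj₂ (var i)

  splitTerm : (Fin m → Side) → Term (C₁ ⊎ C₂) m → SplitTerm m
  splitTerm sd (var i)         = varOn (sd i) i
  splitTerm sd (cst (inj₁ c)) = inj₁ (cst c)
  splitTerm sd (cst (inj₂ c)) = inj₂ (cst c)

  edgeᴰ : SplitTerm m → SplitTerm m → DNF m k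
  edgeᴰ (inj₁ a) (inj₁ b) = [ edge a b , ⊤ᶠ c₂ ]
  edgeᴰ (inj₂ a) (inj₂ b) = [ ⊤ᶠ c₁ , edge a b ]
  edgeᴰ (inj₁ a) (inj₂ b) = [ eq a (cst c₁) , eq b (cst c₂) ]
  edgeᴰ (inj₂ a) (inj₁ b) = [ eq b (cst c₁) , eq a (cst c₂) ]

  eqᴰ : SplitTerm m → SplitTerm m → DNF m k
  eqᴰ (inj₁ a) (inj₁ b) = [ eq a b , ⊤ᶠ c₂ ]
  eqᴰ (inj₂ a) (inj₂ b) = [ ⊤ᶠ c₁ , eq a b ]
  eqᴰ (inj₁ a) (inj₂ b) = []
  eqᴰ (inj₂ a) (inj₁ b) = []

  relᴰ : Fin s → SplitTerm m → DNF m k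
  relᴰ v (inj₁ a) = [ rel v a , ⊤ᶠ c₂ ]
  relᴰ v (inj₂ b) = [ ⊤ᶠ c₁ , rel v b ]

  memᴰ : Fin k → SplitTerm m → DNF m k
  memᴰ j (inj₁ a) = [ mem j a , ⊤ᶠ c₂ ]
  memᴰ j (inj₂ b) = [ ⊤ᶠ c₁ , mem j b ]

  translate : (Fin m → Side) → Formula s (C₁ ⊎ C₂) m k → DNF m k
  translate sd (edge t u) = edgeᴰ (splitTerm sd t) (splitTerm sd u)
  translate sd (eq t u)   = eqᴰ (splitTerm sd t) (splitTerm sd u)
  translate sd (rel v t)  = relᴰ v (splitTerm sd t)
  translate sd (mem j t)  = memᴰ j (splitTerm sd t)
  translate sd (neg φ)    = ¬ᴰ (translate sd φ)
  translate sd (and φ ψ)  = translate sd φ ∧ᴰ translate sd ψ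
  translate sd (or φ ψ)   = translate sd φ ++ translate sd ψ
  translate sd (ex1 φ)    = ∃ᴰ (translate (ext₀ sd left) φ) (translate (ext₀ sd right) φ)
  translate sd (all1 φ)   =
    ¬ᴰ (∃ᴰ (¬ᴰ (translate (ext₀ sd left) φ)) (¬ᴰ (translate (ext₀ sd right) φ)))
  translate sd (ex2 φ)    = map ∃²ᶜ (translate sd φ)
  translate sd (all2 φ)   = ¬ᴰ (map ∃²ᶜ (¬ᴰ (translate sd φ)))

  module Fragment (X : Fin s) where

    InFragmentᶜ : ℕ → Bool → Clause m k → Set
    InFragmentᶜ r p (ψ , χ) = InFragment X r p ψ × InFragment X r p χ

    polarOK-not-not : ∀ {C} p (φ : Formula s C m k) →
                      T (polarOK X p φ) → T (polarOK X (not (not p)) φ)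
    polarOK-not-not true  φ pol = pol
    polarOK-not-not false φ pol = pol

    ∧ᴰ-fragment : ∀ {r p} {D D′ : DNF m k} →
                  All (InFragmentᶜ r p) D → All (InFragmentᶜ r p) D′ → All (InFragmentᶜ r p) (D ∧ᴰ D′)
    ∧ᴰ-fragment {D = D} {D′} fD fD′ =
      Allₚ.cartesianProductWith⁺ (setoid _) (setoid _) _∧ᶜ_ D D′ λ {x} {y} x∈ y∈ →
        conj x y (All.lookup fD x∈) (All.lookup fD′ y∈)
      where
      conj : ∀ {r p} (x y : Clause m k) → InFragmentᶜ r p x → InFragmentᶜ r p y →
             InFragmentᶜ r p (x ∧ᶜ y)
      conj _ _ ((rψ , pψ) , (rχ , pχ)) ((rψ′ , pψ′) , (rχ′ , pχ′)) =
        (⊔-lub rψ rψ′ , from T-∧ (pψ , pψ′)) , (⊔-lub rχ rχ′ , from T-∧ (pχ , pχ′))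

    ¬ᴰ-fragment : ∀ {r p} {D : DNF m k} →
                  All (InFragmentᶜ r (not p)) D → All (InFragmentᶜ r p) (¬ᴰ D)
    ¬ᴰ-fragment []                           = ((z≤n , tt) , (z≤n , tt)) ∷ []
    ¬ᴰ-fragment (((rψ , pψ) , (rχ , pχ)) ∷ fD) =
      ∧ᴰ-fragment ((((rψ , pψ) , (z≤n , tt)) ∷ ((z≤n , tt) , (rχ , pχ)) ∷ []))
                  (¬ᴰ-fragment fD)

    ∃ᴰ-fragment : ∀ {r p} {D₁ D₂ : DNF (suc m) k} →
                  All (InFragmentᶜ r p) D₁ → All (InFragmentᶜ r p) D₂ → All (InFragmentᶜ (suc r) p) (∃ᴰ D₁ D₂)
    ∃ᴰ-fragment fD₁ fD₂ =
      Allₚ.++⁺ (Allₚ.map⁺ (All.map (λ ((rψ , pψ) , (rχ , pχ)) → (s≤s rψ , pψ) , (s≤s rχ , pχ)) fD₁))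
              (Allₚ.map⁺ (All.map (λ ((rψ , pψ) , (rχ , pχ)) → (s≤s rψ , pψ) , (s≤s rχ , pχ)) fD₂))

    ∃²ᴰ-fragment : ∀ {r p} {D : DNF m (suc k)} → All (InFragmentᶜ r p) D →
                   All (InFragmentᶜ (suc r) p) (map ∃²ᶜ D)
    ∃²ᴰ-fragment fD =
      Allₚ.map⁺ (All.map (λ ((rψ , pψ) , (rχ , pχ)) → (s≤s rψ , pψ) , (s≤s rχ , pχ)) fD)

    translate-fragment : ∀ {r p} (sd : Fin m → Side) (φ : Formula s (C₁ ⊎ C₂) m k) →
                         InFragment X r p φ → All (InFragmentᶜ r p) (translate sd φ)
    translate-fragment sd (edge t u) _ = atom (splitTerm sd t) (splitTerm sd u)
      where
      atom : ∀ {r p} (a b : SplitTerm m) → All (InFragmentᶜ {m} {k} r p) (edgeᴰ a b)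
      atom (inj₁ a) (inj₁ b) = ((z≤n , tt) , (z≤n , tt)) ∷ []
      atom (inj₂ a) (inj₂ b) = ((z≤n , tt) , (z≤n , tt)) ∷ []
      atom (inj₁ a) (inj₂ b) = ((z≤n , tt) , (z≤n , tt)) ∷ []
      atom (inj₂ a) (inj₁ b) = ((z≤n , tt) , (z≤n , tt)) ∷ []
    translate-fragment sd (eq t u) _ = atom (splitTerm sd t) (splitTerm sd u)
      where
      atom : ∀ {r p} (a b : SplitTerm m) → All (InFragmentᶜ {m} {k} r p) (eqᴰ a b)
      atom (inj₁ a) (inj₁ b) = ((z≤n , tt) , (z≤n , tt)) ∷ []
      atom (inj₂ a) (inj₂ b) = ((z≤n , tt) , (z≤n , tt)) ∷ []
      atom (inj₁ a) (inj₂ b) = []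
      atom (inj₂ a) (inj₁ b) = []
    translate-fragment sd (rel v t) (_ , pol) with splitTerm sd t
    ... | inj₁ a = ((z≤n , pol) , (z≤n , tt)) ∷ []
    ... | inj₂ b = ((z≤n , tt) , (z≤n , pol)) ∷ []
    translate-fragment sd (mem j t) _ with splitTerm sd t
    ... | inj₁ a = ((z≤n , tt) , (z≤n , tt)) ∷ []
    ... | inj₂ b = ((z≤n , tt) , (z≤n , tt)) ∷ []
    translate-fragment sd (neg φ) fφ = ¬ᴰ-fragment (translate-fragment sd φ fφ)
    translate-fragment sd (and φ ψ) (r , pol) =
      ∧ᴰ-fragment (translate-fragment sd φ (m⊔n≤o⇒m≤o (qr φ) (qr ψ) r , proj₁ (to T-∧ pol)))
                  (translate-fragment sd ψ (m⊔n≤o⇒n≤o (qr φ) (qr ψ) r , proj₂ (to T-∧ pol)))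
    translate-fragment sd (or φ ψ) (r , pol) =
      Allₚ.++⁺ (translate-fragment sd φ (m⊔n≤o⇒m≤o (qr φ) (qr ψ) r , proj₁ (to T-∧ pol)))
              (translate-fragment sd ψ (m⊔n≤o⇒n≤o (qr φ) (qr ψ) r , proj₂ (to T-∧ pol)))
    translate-fragment sd (ex1 φ) (s≤s r , pol) =
      ∃ᴰ-fragment (translate-fragment (ext₀ sd left) φ (r , pol))
                  (translate-fragment (ext₀ sd right) φ (r , pol))
    translate-fragment {p = p} sd (all1 φ) (s≤s r , pol) =
      ¬ᴰ-fragment (∃ᴰ-fragment
        (¬ᴰ-fragment (translate-fragment (ext₀ sd left) φ (r , polarOK-not-not p φ pol)))
        (¬ᴰ-fragment (translate-fragment (ext₀ sd right) φ (r , polarOK-not-not p φ pol))))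
    translate-fragment sd (ex2 φ) (s≤s r , pol) = ∃²ᴰ-fragment (translate-fragment sd φ (r , pol))
    translate-fragment {p = p} sd (all2 φ) (s≤s r , pol) =
      ¬ᴰ-fragment (∃²ᴰ-fragment (¬ᴰ-fragment (translate-fragment sd φ (r , polarOK-not-not p φ pol))))

  module Semantics (lem : LEM) (T₁ : Structure s C₁) (T₂ : Structure s C₂) where

    S : Structure s (C₁ ⊎ C₂)
    S = T₁ +[ c₁ , c₂ ] T₂

    A₁ A₂ : Set
    A₁ = Carrier T₁
    A₂ = Carrier T₂

    record Env (m k : ℕ) : Set₁ where
      constructor env
      field
        ρ₁ : Fin m → A₁
        η₁ : Fin k → A₁ → Set
        ρ₂ : Fin m → A₂
        η₂ : Fin k → A₂ → Set
    open Env

    Holds : Env m k → Clause m k → Set₁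
    Holds e (ψ , χ) = Sat T₁ (ρ₁ e) (η₁ e) ψ × Sat T₂ (ρ₂ e) (η₂ e) χ

    ⟦_⟧ᴰ : DNF m k → Env m k → Set₁
    ⟦ D ⟧ᴰ e = Any (Holds e) D

    emptyEnv : Env 0 0
    emptyEnv = env (λ ()) (λ ()) (λ ()) (λ ())

    _▷ˡ_ : Env m k → A₁ → Env (suc m) k
    e ▷ˡ a = env (ext₀ (ρ₁ e) a) (η₁ e) (ext₀ (ρ₂ e) (con T₂ c₂)) (η₂ e)

    _▷ʳ_ : Env m k → A₂ → Env (suc m) k
    e ▷ʳ b = env (ext₀ (ρ₁ e) (con T₁ c₁)) (η₁ e) (ext₀ (ρ₂ e) b) (η₂ e)

    _▷²_ : Env m k → (A₁ ⊎ A₂ → Set) → Env m (suc k)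
    e ▷² Q = env (ρ₁ e) (ext (η₁ e) (Q ∘ inj₁)) (ρ₂ e) (ext (η₂ e) (Q ∘ inj₂))

    ⟦_⟧ˢ : SplitTerm m → Env m k → A₁ ⊎ A₂
    ⟦ inj₁ a ⟧ˢ e = inj₁ (⟦ a ⟧t T₁ (ρ₁ e))
    ⟦ inj₂ b ⟧ˢ e = inj₂ (⟦ b ⟧t T₂ (ρ₂ e))

    pick : Side → A₁ → A₂ → A₁ ⊎ A₂
    pick left  a _ = inj₁ a
    pick right _ b = inj₂ b

    record Splits (sd : Fin m → Side) (ρ : Fin m → A₁ ⊎ A₂) (η : Fin k → A₁ ⊎ A₂ → Set)
                  (e : Env m k) : Set₁ where
      field
        vars  : ∀ i → ρ i ≡ pick (sd i) (ρ₁ e i) (ρ₂ e i)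
        sets₁ : ∀ j a → η₁ e j a ≡ η j (inj₁ a)
        sets₂ : ∀ j b → η₂ e j b ≡ η j (inj₂ b)
    open Splits

    emptySplits : Splits (λ ()) (λ ()) (λ ()) emptyEnv
    emptySplits = record { vars = λ () ; sets₁ = λ () ; sets₂ = λ () }

    module _ {sd : Fin m → Side} {ρ : Fin m → A₁ ⊎ A₂} {η : Fin k → A₁ ⊎ A₂ → Set} {e : Env m k}
             (sp : Splits sd ρ η e) where

      Splits-▷ˡ : ∀ a → Splits (ext₀ sd left) (ext₀ ρ (inj₁ a)) η (e ▷ˡ a)
      Splits-▷ˡ a .vars fzero     = refl
      Splits-▷ˡ a .vars (fsuc i)  = vars sp i
      Splits-▷ˡ a .sets₁ = sets₁ sp
      Splits-▷ˡ a .sets₂ = sets₂ sp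

      Splits-▷ʳ : ∀ b → Splits (ext₀ sd right) (ext₀ ρ (inj₂ b)) η (e ▷ʳ b)
      Splits-▷ʳ b .vars fzero     = refl
      Splits-▷ʳ b .vars (fsuc i)  = vars sp i
      Splits-▷ʳ b .sets₁ = sets₁ sp
      Splits-▷ʳ b .sets₂ = sets₂ sp

      Splits-▷² : ∀ Q → Splits sd ρ (ext η Q) (e ▷² Q)
      Splits-▷² Q .vars = vars sp
      Splits-▷² Q .sets₁ fzero    a = refl
      Splits-▷² Q .sets₁ (fsuc j) a = sets₁ sp j a
      Splits-▷² Q .sets₂ fzero    b = refl
      Splits-▷² Q .sets₂ (fsuc j) b = sets₂ sp j b

      splitTerm-sound : ∀ t → ⟦ t ⟧t S ρ ≡ ⟦ splitTerm sd t ⟧ˢ e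
      splitTerm-sound (var i) with sd i | vars sp i
      ... | left  | ρi≡ = ρi≡
      ... | right | ρi≡ = ρi≡
      splitTerm-sound (cst (inj₁ c)) = refl
      splitTerm-sound (cst (inj₂ c)) = refl

    module _ {e : Env m k} where

      singleton-⇔ : {P : Set₁} {x : Clause m k} → P ⇔ Holds e x → P ⇔ ⟦ [ x ] ⟧ᴰ e
      singleton-⇔ P⇔x = mk⇔ (here ∘ to P⇔x) (from P⇔x ∘ Anyₚ.singleton⁻)

      edgeᴰ-sound : ∀ a b → Lift (lsuc 0ℓ) (E S (⟦ a ⟧ˢ e) (⟦ b ⟧ˢ e)) ⇔ ⟦ edgeᴰ a b ⟧ᴰ e
      edgeᴰ-sound (inj₁ a) (inj₁ b) = singleton-⇔ (mk⇔ (_, lift refl) proj₁)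
      edgeᴰ-sound (inj₂ a) (inj₂ b) = singleton-⇔ (mk⇔ (lift refl ,_) proj₂)
      edgeᴰ-sound (inj₁ a) (inj₂ b) =
        singleton-⇔ (mk⇔ (λ (lift (p , q)) → lift p , lift q) (λ (lift p , lift q) → lift (p , q)))
      edgeᴰ-sound (inj₂ a) (inj₁ b) =
        singleton-⇔ (mk⇔ (λ (lift (p , q)) → lift q , lift p) (λ (lift q , lift p) → lift (p , q)))

      eqᴰ-sound : ∀ a b → Lift (lsuc 0ℓ) (⟦ a ⟧ˢ e ≡ ⟦ b ⟧ˢ e) ⇔ ⟦ eqᴰ a b ⟧ᴰ e
      eqᴰ-sound (inj₁ a) (inj₁ b) =
        singleton-⇔ (mk⇔ (λ (lift a≡b) → lift (inj₁-injective a≡b) , lift refl)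
                         (λ (lift a≡b , _) → lift (cong inj₁ a≡b)))
      eqᴰ-sound (inj₂ a) (inj₂ b) =
        singleton-⇔ (mk⇔ (λ (lift a≡b) → lift refl , lift (inj₂-injective a≡b))
                         (λ (_ , lift a≡b) → lift (cong inj₂ a≡b)))
      eqᴰ-sound (inj₁ a) (inj₂ b) = mk⇔ (λ { (lift ()) }) (λ ())
      eqᴰ-sound (inj₂ a) (inj₁ b) = mk⇔ (λ { (lift ()) }) (λ ())

      relᴰ-sound : ∀ v a → Lift (lsuc 0ℓ) (P S v (⟦ a ⟧ˢ e)) ⇔ ⟦ relᴰ v a ⟧ᴰ e
      relᴰ-sound v (inj₁ a) = singleton-⇔ (mk⇔ (_, lift refl) proj₁)
      relᴰ-sound v (inj₂ b) = singleton-⇔ (mk⇔ (lift refl ,_) proj₂)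

      memᴰ-sound : ∀ {sd : Fin m → Side} {ρ η} → Splits sd ρ η e →
                   ∀ j a → Lift (lsuc 0ℓ) (η j (⟦ a ⟧ˢ e)) ⇔ ⟦ memᴰ j a ⟧ᴰ e
      memᴰ-sound sp j (inj₁ a) = singleton-⇔ (mk⇔
        (λ (lift h) → lift (subst id (sym (sets₁ sp j _)) h) , lift refl)
        (λ (lift h , _) → lift (subst id (sets₁ sp j _) h)))
      memᴰ-sound sp j (inj₂ b) = singleton-⇔ (mk⇔
        (λ (lift h) → lift refl , lift (subst id (sym (sets₂ sp j _)) h))
        (λ (_ , lift h) → lift (subst id (sets₂ sp j _) h)))

      ∧ᴰ-sound : ∀ D D′ → ⟦ D ∧ᴰ D′ ⟧ᴰ e ⇔ (⟦ D ⟧ᴰ e × ⟦ D′ ⟧ᴰ e)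
      ∧ᴰ-sound D D′ = mk⇔ (Anyₚ.cartesianProductWith⁻ _∧ᶜ_ split D D′)
                          (λ (h , h′) → Anyₚ.cartesianProductWith⁺ _∧ᶜ_ join h h′)
        where
        split : ∀ {x y} → Holds e (x ∧ᶜ y) → Holds e x × Holds e y
        split {_ , _} {_ , _} ((a , a′) , (b , b′)) = (a , b) , (a′ , b′)
        join : ∀ {x y} → Holds e x → Holds e y → Holds e (x ∧ᶜ y)
        join {_ , _} {_ , _} (a , b) (a′ , b′) = (a , a′) , (b , b′)

      ¬ᴰ-sound : ∀ D → ⟦ ¬ᴰ D ⟧ᴰ e ⇔ (¬ ⟦ D ⟧ᴰ e)
      ¬ᴰ-sound []            = mk⇔ (λ _ ()) (λ _ → here (lift refl , lift refl))
      ¬ᴰ-sound ((ψ , χ) ∷ D) =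
        ⇔-trans (∧ᴰ-sound _ (¬ᴰ D)) (⇔-trans (¬ᶜ-sound ×-⇔ ¬ᴰ-sound D) ¬-∷)
        where
        ¬ᶜ-sound : ⟦ (neg ψ , ⊤ᶠ c₂) ∷ (⊤ᶠ c₁ , neg χ) ∷ [] ⟧ᴰ e ⇔ (¬ Holds e (ψ , χ))
        ¬ᶜ-sound = mk⇔ (λ { (here (¬a , _)) (a , _) → ¬a a ; (there (here (_ , ¬b))) (_ , b) → ¬b b })
                       excluded
          where
          excluded : ¬ Holds e (ψ , χ) → ⟦ (neg ψ , ⊤ᶠ c₂) ∷ (⊤ᶠ c₁ , neg χ) ∷ [] ⟧ᴰ e
          excluded ¬ab with lem (Sat T₁ (ρ₁ e) (η₁ e) ψ)
          ... | yes a = there (here (lift refl , λ b → ¬ab (a , b)))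
          ... | no ¬a = here (¬a , lift refl)
        ¬-∷ : (¬ Holds e (ψ , χ) × ¬ ⟦ D ⟧ᴰ e) ⇔ (¬ ⟦ (ψ , χ) ∷ D ⟧ᴰ e)
        ¬-∷ = mk⇔ (λ { (¬h , _) (here h) → ¬h h ; (_ , ¬hs) (there hs) → ¬hs hs })
                  (λ ¬h∷hs → ¬h∷hs ∘ here , ¬h∷hs ∘ there)

      negate-sound : ∀ {P : Set₁} {D} → P ⇔ ⟦ D ⟧ᴰ e → (¬ P) ⇔ ⟦ ¬ᴰ D ⟧ᴰ e
      negate-sound {D = D} P⇔D = ⇔-trans (¬-cong-⇔ P⇔D) (⇔-sym (¬ᴰ-sound D))

      ∃ˡ-sound : ∀ D → ⟦ map ∃ˡ D ⟧ᴰ e ⇔ Σ A₁ λ a → ⟦ D ⟧ᴰ (e ▷ˡ a)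
      ∃ˡ-sound D = mk⇔ (Anyₚ.Any-Σ⁻ʳ ∘ Any.map unpin ∘ Anyₚ.map⁻)
                       (Anyₚ.map⁺ ∘ Any.map pin ∘ Anyₚ.Any-Σ⁺ʳ)
        where
        unpin : ∀ {x} → Holds e (∃ˡ x) → Σ A₁ λ a → Holds (e ▷ˡ a) x
        unpin {_ , _} ((a , h₁) , (_ , lift refl , h₂)) = a , h₁ , h₂
        pin : ∀ {x} → (Σ A₁ λ a → Holds (e ▷ˡ a) x) → Holds e (∃ˡ x)
        pin {_ , _} (a , h₁ , h₂) = (a , h₁) , (con T₂ c₂ , lift refl , h₂)

      ∃ʳ-sound : ∀ D → ⟦ map ∃ʳ D ⟧ᴰ e ⇔ Σ A₂ λ b → ⟦ D ⟧ᴰ (e ▷ʳ b)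
      ∃ʳ-sound D = mk⇔ (Anyₚ.Any-Σ⁻ʳ ∘ Any.map unpin ∘ Anyₚ.map⁻)
                       (Anyₚ.map⁺ ∘ Any.map pin ∘ Anyₚ.Any-Σ⁺ʳ)
        where
        unpin : ∀ {x} → Holds e (∃ʳ x) → Σ A₂ λ b → Holds (e ▷ʳ b) x
        unpin {_ , _} ((_ , lift refl , h₁) , (b , h₂)) = b , h₁ , h₂
        pin : ∀ {x} → (Σ A₂ λ b → Holds (e ▷ʳ b) x) → Holds e (∃ʳ x)
        pin {_ , _} (b , h₁ , h₂) = (con T₁ c₁ , lift refl , h₁) , (b , h₂)

      ∃²ᶜ-sound : ∀ D → ⟦ map ∃²ᶜ D ⟧ᴰ e ⇔ Σ (A₁ ⊎ A₂ → Set) λ Q → ⟦ D ⟧ᴰ (e ▷² Q)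
      ∃²ᶜ-sound D = mk⇔ (Anyₚ.Any-Σ⁻ʳ ∘ Any.map glue ∘ Anyₚ.map⁻)
                        (Anyₚ.map⁺ ∘ Any.map restrict ∘ Anyₚ.Any-Σ⁺ʳ)
        where
        glue : ∀ {x} → Holds e (∃²ᶜ x) → Σ (A₁ ⊎ A₂ → Set) λ Q → Holds (e ▷² Q) x
        glue {_ , _} ((Q₁ , h₁) , (Q₂ , h₂)) = [ Q₁ , Q₂ ]′ , h₁ , h₂
        restrict : ∀ {x} → (Σ (A₁ ⊎ A₂ → Set) λ Q → Holds (e ▷² Q) x) → Holds e (∃²ᶜ x)
        restrict {_ , _} (Q , h₁ , h₂) = (Q ∘ inj₁ , h₁) , (Q ∘ inj₂ , h₂)

      ∃ᴰ-sound : ∀ {P : A₁ ⊎ A₂ → Set₁} {D₁ D₂} →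
                 (∀ a → P (inj₁ a) ⇔ ⟦ D₁ ⟧ᴰ (e ▷ˡ a)) → (∀ b → P (inj₂ b) ⇔ ⟦ D₂ ⟧ᴰ (e ▷ʳ b)) →
                 Σ (A₁ ⊎ A₂) P ⇔ ⟦ ∃ᴰ D₁ D₂ ⟧ᴰ e
      ∃ᴰ-sound {D₁ = D₁} {D₂} P⇔D₁ P⇔D₂ =
        ⇔-trans (↔⇒⇔ Σ-distribʳ-⊎)
          (⇔-trans (⇔-trans (Σ-cong-⇔ P⇔D₁) (⇔-sym (∃ˡ-sound D₁))
                    ⊎-⇔ ⇔-trans (Σ-cong-⇔ P⇔D₂) (⇔-sym (∃ʳ-sound D₂)))
                   (↔⇒⇔ Anyₚ.++↔))

      ∃²ᴰ-sound : ∀ {P : (A₁ ⊎ A₂ → Set) → Set₁} {D} →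
                  (∀ Q → P Q ⇔ ⟦ D ⟧ᴰ (e ▷² Q)) → Σ (A₁ ⊎ A₂ → Set) P ⇔ ⟦ map ∃²ᶜ D ⟧ᴰ e
      ∃²ᴰ-sound {D = D} P⇔D = ⇔-trans (Σ-cong-⇔ P⇔D) (⇔-sym (∃²ᶜ-sound D))

    translate-sound : ∀ {sd : Fin m → Side} {ρ η} {e : Env m k} (φ : Formula s (C₁ ⊎ C₂) m k) →
                      Splits sd ρ η e → Sat S ρ η φ ⇔ ⟦ translate sd φ ⟧ᴰ e
    translate-sound (edge t u) sp
      rewrite splitTerm-sound sp t | splitTerm-sound sp u = edgeᴰ-sound _ _
    translate-sound (eq t u)   sp
      rewrite splitTerm-sound sp t | splitTerm-sound sp u = eqᴰ-sound _ _
    translate-sound (rel v t)  sp rewrite splitTerm-sound sp t = relᴰ-sound v _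
    translate-sound (mem j t)  sp rewrite splitTerm-sound sp t = memᴰ-sound sp j _
    translate-sound (neg φ)    sp = negate-sound (translate-sound φ sp)
    translate-sound (and φ ψ)  sp =
      ⇔-trans (translate-sound φ sp ×-⇔ translate-sound ψ sp) (⇔-sym (∧ᴰ-sound _ _))
    translate-sound (or φ ψ)   sp =
      ⇔-trans (translate-sound φ sp ⊎-⇔ translate-sound ψ sp) (↔⇒⇔ Anyₚ.++↔)
    translate-sound (ex1 φ)    sp =
      ∃ᴰ-sound (λ a → translate-sound φ (Splits-▷ˡ sp a)) (λ b → translate-sound φ (Splits-▷ʳ sp b))
    translate-sound (all1 φ)   sp = ⇔-trans (∀⇔¬∃¬ lem) (negate-sound (∃ᴰ-sound
      (λ a → negate-sound (translate-sound φ (Splits-▷ˡ sp a)))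
      (λ b → negate-sound (translate-sound φ (Splits-▷ʳ sp b)))))
    translate-sound (ex2 φ)    sp = ∃²ᴰ-sound (λ Q → translate-sound φ (Splits-▷² sp Q))
    translate-sound (all2 φ)   sp = ⇔-trans (∀⇔¬∃¬ lem) (negate-sound (∃²ᴰ-sound
      (λ Q → negate-sound (translate-sound φ (Splits-▷² sp Q)))))

module TypeSum {s : ℕ} {C₁ C₂ : Set} (c₁ : C₁) (c₂ : C₂) (X : Fin s) (n : ℕ) where
  open Decomposition {s} c₁ c₂
  open TypeMembership X n

  bothContain : TypeRep s X C₁ n → TypeRep s X C₂ n → Clause 0 0 → Bool
  bothContain t₁ t₂ (ψ , χ) = contains t₁ ψ ∧ contains t₂ χ

  evalᴰ : TypeRep s X C₁ n → TypeRep s X C₂ n → DNF 0 0 → Bool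
  evalᴰ t₁ t₂ = any (bothContain t₁ t₂)

  evalᴰ-mono : ∀ {t₁ t₁′ t₂ t₂′} → t₁ ⊆ᵗ t₁′ → t₂ ⊆ᵗ t₂′ →
               ∀ D → T (evalᴰ t₁ t₂ D) → T (evalᴰ t₁′ t₂′ D)
  evalᴰ-mono {t₁} {t₁′} {t₂} {t₂′} t₁⊆t₁′ t₂⊆t₂′ D =
    Anyₚ.any⁺ (bothContain t₁′ t₂′) ∘ Any.map (λ {x} → mono {x})
      ∘ Anyₚ.any⁻ (bothContain t₁ t₂) D
    where
    mono : ∀ {x} → T (bothContain t₁ t₂ x) → T (bothContain t₁′ t₂′ x)
    mono {ψ , χ} h = let (hψ , hχ) = to T-∧ h in
      from T-∧ (contains-mono t₁⊆t₁′ ψ hψ , contains-mono t₂⊆t₂′ χ hχ)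

  _⊕_ : TypeRep s X C₁ n → TypeRep s X C₂ n → TypeRep s X (C₁ ⊎ C₂) n
  (t₁ ⊕ t₂) (φ , _) = evalᴰ t₁ t₂ (translate (λ ()) φ)

  ⊕-mono : ∀ {t₁ t₁′ t₂ t₂′} → t₁ ⊆ᵗ t₁′ → t₂ ⊆ᵗ t₂′ → (t₁ ⊕ t₂) ⊆ᵗ (t₁′ ⊕ t₂′)
  ⊕-mono t₁⊆t₁′ t₂⊆t₂′ (φ , _) = evalᴰ-mono t₁⊆t₁′ t₂⊆t₂′ (translate (λ ()) φ)

  module _ (lem : LEM) (T₁ : Structure s C₁) (T₂ : Structure s C₂) where
    open Semantics lem T₁ T₂

    evalᴰ-tp : ∀ {D} → All (Fragment.InFragmentᶜ X n true) D →
               T (evalᴰ (tp lem X n T₁) (tp lem X n T₂) D) ⇔ ⟦ D ⟧ᴰ emptyEnv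
    evalᴰ-tp {D} fD =
      ⇔-trans (mk⇔ (Anyₚ.any⁻ _ D) (Anyₚ.any⁺ _))
              (Any-cong-⇔ᴬ fD λ { {ψ , χ} (fψ , fχ) →
                 ⇔-trans T-∧ (contains-tp lem T₁ fψ ×-⇔ contains-tp lem T₂ fχ) })

    tp-+ : tp lem X n (T₁ +[ c₁ , c₂ ] T₂) ≗ tp lem X n T₁ ⊕ tp lem X n T₂
    tp-+ (φ , r , pol) = trans (isYes≗does (lem _)) (does-⇔ S⊨φ⇔ (lem _) (T? _))
      where
      S⊨φ⇔ : (S ⊨ φ) ⇔ T ((tp lem X n T₁ ⊕ tp lem X n T₂) (φ , r , pol))
      S⊨φ⇔ = ⇔-trans (translate-sound φ emptySplits)
               (⇔-sym (evalᴰ-tp (Fragment.translate-fragment X (λ ()) φ (≤ᵇ⇒≤ (qr φ) n r , pol))))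

proposition3p2 : (s : ℕ) (X : Fin s) (k₁ k₂ : ℕ) (c₁ : Fin k₁) (c₂ : Fin k₂) →
    Σ ((n : ℕ) → TypeRep s X (Fin k₁) n → TypeRep s X (Fin k₂) n →
         TypeRep s X (Fin k₁ ⊎ Fin k₂) n) λ ⊕ →
      (lem : LEM) (n : ℕ) →
        ((T₁ : Structure s (Fin k₁)) (T₂ : Structure s (Fin k₂)) →
          IsTree T₁ → IsTree T₂ →
          tp lem X n (T₁ +[ c₁ , c₂ ] T₂) ≗ ⊕ n (tp lem X n T₁) (tp lem X n T₂))
        ×
        ((M₁ M₁′ : Structure s (Fin k₁)) (M₂ M₂′ : Structure s (Fin k₂)) →
          tp lem X n M₁ ⊆ᵗ tp lem X n M₁′ → tp lem X n M₂ ⊆ᵗ tp lem X n M₂′ →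
          ⊕ n (tp lem X n M₁) (tp lem X n M₂) ⊆ᵗ ⊕ n (tp lem X n M₁′) (tp lem X n M₂′))
proposition3p2 s X k₁ k₂ c₁ c₂ =
  (λ n → TypeSum._⊕_ c₁ c₂ X n) ,
  λ lem n → (λ T₁ T₂ _ _ → TypeSum.tp-+ c₁ c₂ X n lem T₁ T₂) ,
            (λ _ _ _ _ → TypeSum.⊕-mono c₁ c₂ X n)
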